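{- If a graph $G$ has $n$ vertices and $m\ge 12n$ edges, then $G$ contains an induced subgraph $H$ with at least $\frac{m^3}{32n^4}$ edges that has diameter at most $3$.
   Context: The diameter of a graph is the maximum distance between two of its vertices ($\infty$ if disconnected). -}

module Defs where

open import Data.Nat using (ℕ; zero; suc; _+_; _*_; _≤_)
open import Data.Fin using (Fin; _<_)
open import Data.Fin.Subset using (Subset; _∈_)
open import Data.Bool using (Bool; true; false)
open import Data.List using (List; length; filter)
open import Data.List using (allFin)
open import Data.Product using (Σ; ∃; _×_; _,_; proj₁)
open import Relation.Binary.PropositionalEquality using (_≡_)
open import Relation.Nullary using (¬_)
open import Data.Fin.Properties using (_<?_)
open import Data.List using (cartesianProduct)
open import Relation.Unary using (Decidable)
open import Data.Sum using (_⊎_)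
open import Data.Bool.Properties using (_≟_)

record Graph (n : ℕ) : Set where
  field
    adj   : Fin n → Fin n → Bool
    sym   : ∀ i j → adj i j ≡ adj j i
    irrefl : ∀ i → adj i i ≡ false
open Graph public

Adj : ∀ {n} → Graph n → Fin n → Fin n → Set
Adj G i j = adj G i j ≡ true

isInducedEdge : ∀ {n} → Graph n → Subset n → Fin n × Fin n → Set
isInducedEdge G S (i , j) = (i < j) × ((i ∈ S) × ((j ∈ S) × Adj G i j))

open import Relation.Nullary using (Dec; yes; no)
open import Relation.Nullary.Decidable using (_×-dec_)
open import Data.Fin.Subset.Properties using (_∈?_)

isInducedEdge? : ∀ {n} (G : Graph n) (S : Subset n) → Decidable (isInducedEdge G S)
isInducedEdge? G S (i , j) =
  (i <? j) ×-dec ((i ∈? S) ×-dec ((j ∈? S) ×-dec (adj G i j ≟ true)))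

inducedEdges : ∀ {n} → Graph n → Subset n → ℕ
inducedEdges {n} G S =
  length (filter (isInducedEdge? G S) (cartesianProduct (allFin n) (allFin n)))

open import Data.Fin.Subset using (⊤)

edges : ∀ {n} → Graph n → ℕ
edges G = inducedEdges G ⊤

-- WalkIn G S k u v : there is a walk from u to v of length at most k
-- all of whose vertices lie in S (u and v themselves are assumed in S).
WalkIn : ∀ {n} → Graph n → Subset n → ℕ → Fin n → Fin n → Set
WalkIn G S zero    u v = u ≡ v
WalkIn G S (suc k) u v =
  (u ≡ v) ⊎ (Σ (Fin _) λ w → (w ∈ S) × (Adj G u w × WalkIn G S k w v))

-- The induced subgraph G[S] has diameter at most d:
-- any two vertices of S are at distance ≤ d in G[S]
-- (in particular G[S] is connected, since diameter is ∞ otherwise).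
InducedDiamAtMost : ∀ {n} → Graph n → Subset n → ℕ → Set
InducedDiamAtMost G S d = ∀ u v → u ∈ S → v ∈ S → WalkIn G S d u v

module Submission where

-- Let A be the adjacency matrix and s = 2m the sum of its entries. Cauchy–Schwarz, once over
-- the degrees and once over the entries of A², gives s⁴ ≤ n⁴ tr(A⁴), and
-- tr(A⁴) = Σ_{u,v} A_uv (A³)_uv. Averaging over the s ordered edges yields an edge uv with
-- (A³)_uv of order s³/n⁴. Each walk u–x–y–v uses an edge xy of the subgraph induced by
-- N(u) ∪ N(v), so that subgraph has at least (A³)_uv / 2 edges; and since u ~ v, any two of
-- its vertices are joined inside it through u and v by a walk of length at most 3.

open import Defs hiding (sym)
open import Data.Nat using (ℕ; zero; suc; _+_; _*_; _^_; _≤_; _<_; z≤n; z<s; >-nonZero)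
open import Data.Nat.Properties hiding (_≟_)
open import Data.Nat.Tactic.RingSolver using (solve-∀)
open import Data.Fin using (Fin; zero; suc)
import Data.Fin.Properties as Fin
open import Data.Fin.Subset using (Subset; _∈_; _∪_; ⊤) renaming (⊥ to ∅)
open import Data.Fin.Subset.Properties using (_∈?_; ∈⊤; ∉⊥; x∈p∪q⁺; x∈p∪q⁻)
open import Data.Bool using (true; false)
open import Data.Bool.Properties using (_≟_)
open import Data.Vec as Vec using ()
open import Data.Vec.Properties using (lookup⇒[]=; []=⇒lookup; lookup∘tabulate)
open import Data.List using (length; filter; tabulate; map; _++_; cartesianProduct)
open import Data.List.Properties using (length-++; filter-++; map-tabulate)
open import Data.Product using (Σ; ∃; ∃₂; _×_; _,_)
open import Data.Sum using (_⊎_; inj₁; inj₂)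
open import Function using (_∘_; id)
open import Relation.Nullary using (Dec; _because_; yes; no; contradiction)
open import Relation.Nullary.Decidable using (_×-dec_)
open import Relation.Unary using (Pred; Decidable)
open import Relation.Binary.Definitions using (tri<; tri≈; tri>)
open import Relation.Binary.PropositionalEquality
open import Algebra.Properties.Semiring.Sum +-*-semiring
  using (sum; sum-syntax; ∑-comm; ∑-distrib-+; *-distribˡ-sum; *-distribʳ-sum; sum-cong-≗)

∑-mono-≤ : ∀ {n} {f g : Fin n → ℕ} → (∀ i → f i ≤ g i) → sum f ≤ sum g
∑-mono-≤ {zero}  f≤g = z≤n
∑-mono-≤ {suc n} f≤g = +-mono-≤ (f≤g zero) (∑-mono-≤ (f≤g ∘ suc))

∑-const : ∀ n c → ∑[ i < n ] c ≡ n * c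
∑-const zero    c = refl
∑-const (suc n) c = cong (c +_) (∑-const n c)

∑<∑⇒∃< : ∀ {n} (f g : Fin n → ℕ) → sum f < sum g → ∃ λ i → f i < g i
∑<∑⇒∃< {suc n} f g ∑f<∑g with f zero <? g zero
... | yes f₀<g₀ = zero , f₀<g₀
... | no  f₀≮g₀ =
  let i , fᵢ<gᵢ = ∑<∑⇒∃< (f ∘ suc) (g ∘ suc)
                    (+-cancelˡ-< (g zero) _ _ (≤-<-trans (+-monoˡ-≤ _ (≮⇒≥ f₀≮g₀)) ∑f<∑g))
  in suc i , fᵢ<gᵢ

∑-*-∑ : ∀ {m n} (f : Fin m → ℕ) (g : Fin n → ℕ) → sum f * sum g ≡ ∑[ i < m ] ∑[ j < n ] (f i * g j)
∑-*-∑ f g = trans (*-distribʳ-sum (sum g) f) (sum-cong-≗ λ i → *-distribˡ-sum (f i) g)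

*-distribˡ-∑∑ : ∀ {m n} k (M : Fin m → Fin n → ℕ) → k * ∑[ i < m ] sum (M i) ≡ ∑[ i < m ] ∑[ j < n ] (k * M i j)
*-distribˡ-∑∑ k M = trans (*-distribˡ-sum k (sum ∘ M)) (sum-cong-≗ λ i → *-distribˡ-sum k (M i))

m≤n⇒2mn≤m²+n² : ∀ {m n} → m ≤ n → 2 * (m * n) ≤ m * m + n * n
m≤n⇒2mn≤m²+n² {m} m≤n with m≤n⇒∃[o]m+o≡n m≤n
... | d , refl = subst (2 * (m * (m + d)) ≤_) (square-gap m d) (m≤m+n _ (d * d))
  where
  square-gap : ∀ m d → 2 * (m * (m + d)) + d * d ≡ m * m + (m + d) * (m + d)
  square-gap = solve-∀

2mn≤m²+n² : ∀ m n → 2 * (m * n) ≤ m * m + n * n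
2mn≤m²+n² m n with ≤-total m n
... | inj₁ m≤n = m≤n⇒2mn≤m²+n² m≤n
... | inj₂ n≤m = subst₂ _≤_ (cong (2 *_) (*-comm n m)) (+-comm (n * n) (m * m)) (m≤n⇒2mn≤m²+n² n≤m)

∑²≤n*∑² : ∀ {n} (f : Fin n → ℕ) → sum f * sum f ≤ n * ∑[ i < n ] (f i * f i)
∑²≤n*∑² {n} f = *-cancelˡ-≤ 2 (begin
  2 * (sum f * sum f)                                ≡⟨ cong (2 *_) (∑-*-∑ f f) ⟩
  2 * ∑[ i < n ] ∑[ j < n ] (f i * f j)              ≡⟨ *-distribˡ-∑∑ 2 (λ i j → f i * f j) ⟩
  ∑[ i < n ] ∑[ j < n ] (2 * (f i * f j))            ≤⟨ ∑-mono-≤ (λ i → ∑-mono-≤ (λ j → 2mn≤m²+n² (f i) (f j))) ⟩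
  ∑[ i < n ] ∑[ j < n ] (f i * f i + f j * f j)      ≡⟨ sum-cong-≗ (λ i → ∑-distrib-+ (λ _ → f i * f i) (λ j → f j * f j)) ⟩
  ∑[ i < n ] (∑[ j < n ] (f i * f i) + Q)            ≡⟨ sum-cong-≗ (λ i → cong (_+ Q) (∑-const n (f i * f i))) ⟩
  ∑[ i < n ] (n * (f i * f i) + Q)                   ≡⟨ ∑-distrib-+ (λ i → n * (f i * f i)) (λ _ → Q) ⟩
  ∑[ i < n ] (n * (f i * f i)) + ∑[ i < n ] Q        ≡⟨ cong₂ _+_ (sym (*-distribˡ-sum n (λ i → f i * f i))) (∑-const n Q) ⟩
  n * Q + n * Q                                      ≡⟨ cong (n * Q +_) (sym (+-identityʳ (n * Q))) ⟩
  2 * (n * Q)                                        ∎)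
  where
  open ≤-Reasoning
  Q = ∑[ i < n ] (f i * f i)

m*o<n*o⇒o>0 : ∀ m n o → m * o < n * o → 0 < o
m*o<n*o⇒o>0 m n zero    mo<no rewrite *-zeroʳ m | *-zeroʳ n = contradiction mo<no n≮0
m*o<n*o⇒o>0 m n (suc o) _     = z<s

module SymmetricMatrix {n} (M : Fin n → Fin n → ℕ) (M-sym : ∀ i j → M i j ≡ M j i) where

  degree : Fin n → ℕ
  degree i = sum (M i)

  total : ℕ
  total = sum degree

  M² : Fin n → Fin n → ℕ
  M² x v = ∑[ u < n ] (M x u * M u v)

  M³ : Fin n → Fin n → ℕ
  M³ u v = ∑[ x < n ] ∑[ y < n ] (M u x * (M x y * M y v))

  trace-M⁴ : ℕ
  trace-M⁴ = ∑[ u < n ] ∑[ v < n ] (M u v * M³ u v)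

  ∑∑M²≡∑degree² : ∑[ x < n ] sum (M² x) ≡ ∑[ u < n ] (degree u * degree u)
  ∑∑M²≡∑degree² = begin
    ∑[ x < n ] ∑[ v < n ] ∑[ u < n ] (M x u * M u v)  ≡⟨ sum-cong-≗ (λ x → ∑-comm (λ v u → M x u * M u v)) ⟩
    ∑[ x < n ] ∑[ u < n ] ∑[ v < n ] (M x u * M u v)  ≡⟨ ∑-comm (λ x u → ∑[ v < n ] (M x u * M u v)) ⟩
    ∑[ u < n ] ∑[ x < n ] ∑[ v < n ] (M x u * M u v)  ≡⟨ sum-cong-≗ (λ u → sum-cong-≗ λ x → sum-cong-≗ λ v → cong (_* M u v) (M-sym x u)) ⟩
    ∑[ u < n ] ∑[ x < n ] ∑[ v < n ] (M u x * M u v)  ≡⟨ sum-cong-≗ (λ u → sym (∑-*-∑ (M u) (M u))) ⟩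
    ∑[ u < n ] (degree u * degree u)                   ∎
    where open ≡-Reasoning

  trace-M⁴≡∑∑M²² : trace-M⁴ ≡ ∑[ x < n ] ∑[ v < n ] (M² x v * M² x v)
  trace-M⁴≡∑∑M²² = begin
    trace-M⁴                                           ≡⟨ sum-cong-≗ (λ u → sum-cong-≗ λ v → *-distribˡ-∑∑ (M u v) (λ x y → M u x * (M x y * M y v))) ⟩
    ∑[ u < n ] ∑[ v < n ] ∑[ x < n ] W u v x           ≡⟨ ∑-comm (λ u v → ∑[ x < n ] W u v x) ⟩
    ∑[ v < n ] ∑[ u < n ] ∑[ x < n ] W u v x           ≡⟨ sum-cong-≗ (λ v → ∑-comm (λ u x → W u v x)) ⟩
    ∑[ v < n ] ∑[ x < n ] ∑[ u < n ] W u v x           ≡⟨ ∑-comm (λ v x → ∑[ u < n ] W u v x) ⟩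
    ∑[ x < n ] ∑[ v < n ] ∑[ u < n ] W u v x           ≡⟨ sum-cong-≗ (λ x → sum-cong-≗ λ v → sum-cong-≗ λ u → sum-cong-≗ λ y → walk-reversal u v x y) ⟩
    ∑[ x < n ] ∑[ v < n ] ∑[ u < n ] ∑[ y < n ] ((M x u * M u v) * (M x y * M y v))
                                                       ≡⟨ sum-cong-≗ (λ x → sum-cong-≗ λ v → sym (∑-*-∑ (λ u → M x u * M u v) (λ y → M x y * M y v))) ⟩
    ∑[ x < n ] ∑[ v < n ] (M² x v * M² x v)            ∎
    where
    open ≡-Reasoning
    W : Fin n → Fin n → Fin n → ℕ
    W u v x = ∑[ y < n ] (M u v * (M u x * (M x y * M y v)))
    walk-reversal : ∀ u v x y → M u v * (M u x * (M x y * M y v)) ≡ (M x u * M u v) * (M x y * M y v)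
    walk-reversal u v x y = trans (reassoc (M u v) (M u x) (M x y * M y v)) (cong (λ t → (t * M u v) * (M x y * M y v)) (M-sym u x))
      where
      reassoc : ∀ a b c → a * (b * c) ≡ (b * a) * c
      reassoc = solve-∀

  total⁴≤n⁴*trace-M⁴ : total ^ 4 ≤ n ^ 4 * trace-M⁴
  total⁴≤n⁴*trace-M⁴ = begin
    total ^ 4                            ≡⟨ square-of-square total ⟩
    (total * total) * (total * total)    ≤⟨ *-mono-≤ (∑²≤n*∑² degree) (∑²≤n*∑² degree) ⟩
    (n * Q) * (n * Q)                    ≡⟨ regroup n Q ⟩
    n * n * (Q * Q)                      ≤⟨ *-monoʳ-≤ (n * n) Q²≤n²*∑∑M²² ⟩
    n * n * (n * (n * ∑∑M²²))            ≡⟨ cong (λ t → n * n * (n * (n * t))) (sym trace-M⁴≡∑∑M²²) ⟩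
    n * n * (n * (n * trace-M⁴))         ≡⟨ square-of-square-* n trace-M⁴ ⟩
    n ^ 4 * trace-M⁴                     ∎
    where
    open ≤-Reasoning
    Q = ∑[ u < n ] (degree u * degree u)
    ∑∑M²² = ∑[ x < n ] ∑[ v < n ] (M² x v * M² x v)
    square-of-square : ∀ t → t * (t * (t * (t * 1))) ≡ (t * t) * (t * t)
    square-of-square = solve-∀
    regroup : ∀ n q → (n * q) * (n * q) ≡ n * n * (q * q)
    regroup = solve-∀
    square-of-square-* : ∀ n t → n * n * (n * (n * t)) ≡ n * (n * (n * (n * 1))) * t
    square-of-square-* = solve-∀
    Q²≤n²*∑∑M²² : Q * Q ≤ n * (n * ∑∑M²²)
    Q²≤n²*∑∑M²² = begin
      Q * Q                                          ≡⟨ cong₂ _*_ (sym ∑∑M²≡∑degree²) (sym ∑∑M²≡∑degree²) ⟩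
      sum (sum ∘ M²) * sum (sum ∘ M²)                ≤⟨ ∑²≤n*∑² (sum ∘ M²) ⟩
      n * ∑[ x < n ] (sum (M² x) * sum (M² x))       ≤⟨ *-monoʳ-≤ n (∑-mono-≤ λ x → ∑²≤n*∑² (M² x)) ⟩
      n * ∑[ x < n ] (n * ∑[ v < n ] (M² x v * M² x v)) ≡⟨ cong (n *_) (sym (*-distribˡ-sum n (λ x → ∑[ v < n ] (M² x v * M² x v)))) ⟩
      n * (n * ∑∑M²²)                                ∎

  -- The factor 2 makes the averaging inequality strict, which is what ∑<∑⇒∃< needs.
  entry-with-many-walks : 0 < total → ∃₂ λ u v → 0 < M u v × total ^ 3 < 2 * n ^ 4 * M³ u v
  entry-with-many-walks total>0 =
    let u , row< = ∑<∑⇒∃< _ _ weighted-sums<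
        v , entry< = ∑<∑⇒∃< (λ v → total ^ 3 * M u v) (λ v → c * M³ u v * M u v) row<
    in u , v , m*o<n*o⇒o>0 (total ^ 3) (c * M³ u v) (M u v) entry< , *-cancelʳ-< (M u v) (total ^ 3) (c * M³ u v) entry<
    where
    open ≤-Reasoning
    c = 2 * n ^ 4
    t⁴ = total ^ 4
    weighted-sums< : ∑[ u < n ] ∑[ v < n ] (total ^ 3 * M u v) < ∑[ u < n ] ∑[ v < n ] (c * M³ u v * M u v)
    weighted-sums< = begin-strict
      ∑[ u < n ] ∑[ v < n ] (total ^ 3 * M u v)   ≡⟨ sym (*-distribˡ-∑∑ (total ^ 3) M) ⟩
      total ^ 3 * total                          ≡⟨ *-comm (total ^ 3) total ⟩
      t⁴                                         <⟨ m<m+n t⁴ (m^n>0 total {{>-nonZero total>0}} 4) ⟩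
      t⁴ + t⁴                                    ≡⟨ cong (t⁴ +_) (sym (+-identityʳ t⁴)) ⟩
      2 * t⁴                                     ≤⟨ *-monoʳ-≤ 2 total⁴≤n⁴*trace-M⁴ ⟩
      2 * (n ^ 4 * trace-M⁴)                     ≡⟨ sym (*-assoc 2 (n ^ 4) trace-M⁴) ⟩
      c * trace-M⁴                               ≡⟨ *-distribˡ-∑∑ c (λ u v → M u v * M³ u v) ⟩
      ∑[ u < n ] ∑[ v < n ] (c * (M u v * M³ u v)) ≡⟨ sum-cong-≗ (λ u → sum-cong-≗ λ v → regroup c (M u v) (M³ u v)) ⟩
      ∑[ u < n ] ∑[ v < n ] (c * M³ u v * M u v)  ∎
      where
      regroup : ∀ c m w → c * (m * w) ≡ c * w * m
      regroup = solve-∀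

𝟙 : ∀ {p} {P : Set p} → Dec P → ℕ
𝟙 (true  because _) = 1
𝟙 (false because _) = 0

module _ {p q} {P : Set p} {Q : Set q} where

  𝟙-×-dec : (p? : Dec P) (q? : Dec Q) → 𝟙 (p? ×-dec q?) ≡ 𝟙 p? * 𝟙 q?
  𝟙-×-dec (yes _) (yes _) = refl
  𝟙-×-dec (yes _) (no  _) = refl
  𝟙-×-dec (no  _) _       = refl

  𝟙-mono : (P → Q) → (p? : Dec P) (q? : Dec Q) → 𝟙 p? ≤ 𝟙 q?
  𝟙-mono P→Q (yes p) (no ¬q) = contradiction (P→Q p) ¬q
  𝟙-mono _   (yes _) (yes _) = ≤-refl
  𝟙-mono _   (no  _) _       = z≤n

𝟙-yes : ∀ {p} {P : Set p} (p? : Dec P) → P → 𝟙 p? ≡ 1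
𝟙-yes (yes _) _ = refl
𝟙-yes (no ¬p) p = contradiction p ¬p

𝟙>0⇒ : ∀ {p} {P : Set p} (p? : Dec P) → 0 < 𝟙 p? → P
𝟙>0⇒ (yes p) _ = p

length-filter-tabulate : ∀ {a p} {A : Set a} {P : Pred A p} (P? : Decidable P) {n} (f : Fin n → A) →
  length (filter P? (tabulate f)) ≡ ∑[ i < n ] 𝟙 (P? (f i))
length-filter-tabulate P? {zero}  f = refl
length-filter-tabulate P? {suc n} f with P? (f zero)
... | yes _ = cong suc (length-filter-tabulate P? (f ∘ suc))
... | no  _ = length-filter-tabulate P? (f ∘ suc)

length-filter-cartesianProduct : ∀ {a b p} {A : Set a} {B : Set b} {P : Pred (A × B) p} (P? : Decidable P)
  {m n} (f : Fin m → A) (g : Fin n → B) →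
  length (filter P? (cartesianProduct (tabulate f) (tabulate g))) ≡ ∑[ i < m ] ∑[ j < n ] 𝟙 (P? (f i , g j))
length-filter-cartesianProduct P? {zero}  f g = refl
length-filter-cartesianProduct P? {suc m} f g = begin
  length (filter P? (first-row ++ rest))                ≡⟨ cong length (filter-++ P? first-row rest) ⟩
  length (filter P? first-row ++ filter P? rest)        ≡⟨ length-++ (filter P? first-row) ⟩
  length (filter P? first-row) + length (filter P? rest)
    ≡⟨ cong₂ _+_ (trans (cong (length ∘ filter P?) (map-tabulate g (f zero ,_))) (length-filter-tabulate P? (λ j → f zero , g j)))
                 (length-filter-cartesianProduct P? (f ∘ suc) g) ⟩
  ∑[ j < _ ] 𝟙 (P? (f zero , g j)) + ∑[ i < m ] ∑[ j < _ ] 𝟙 (P? (f (suc i) , g j)) ∎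
  where
  open ≡-Reasoning
  first-row = map (f zero ,_) (tabulate g)
  rest = cartesianProduct (tabulate (f ∘ suc)) (tabulate g)

∑∑-upper-triangle : ∀ {n} (w : Fin n → Fin n → ℕ) → (∀ i j → w i j ≡ w j i) → (∀ i → w i i ≡ 0) →
  2 * ∑[ i < n ] ∑[ j < n ] (𝟙 (i Fin.<? j) * w i j) ≡ ∑[ i < n ] sum (w i)
∑∑-upper-triangle {n} w w-sym w-diag = begin
  2 * U                                                         ≡⟨ cong (U +_) (+-identityʳ U) ⟩
  U + U                                                         ≡⟨ cong (U +_) upper≡lower ⟩
  U + ∑[ i < n ] ∑[ j < n ] (𝟙 (j Fin.<? i) * w i j)            ≡⟨ sym (∑∑-distrib-+ _ _) ⟩
  ∑[ i < n ] ∑[ j < n ] (𝟙 (i Fin.<? j) * w i j + 𝟙 (j Fin.<? i) * w i j) ≡⟨ sum-cong-≗ (λ i → sum-cong-≗ (split i)) ⟩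
  ∑[ i < n ] sum (w i)                                          ∎
  where
  open ≡-Reasoning
  U = ∑[ i < n ] ∑[ j < n ] (𝟙 (i Fin.<? j) * w i j)
  upper≡lower : U ≡ ∑[ i < n ] ∑[ j < n ] (𝟙 (j Fin.<? i) * w i j)
  upper≡lower = trans (∑-comm (λ i j → 𝟙 (i Fin.<? j) * w i j))
                      (sum-cong-≗ λ j → sum-cong-≗ λ i → cong (𝟙 (i Fin.<? j) *_) (w-sym i j))
  ∑∑-distrib-+ : (f g : Fin n → Fin n → ℕ) → ∑[ i < n ] ∑[ j < n ] (f i j + g i j) ≡ ∑[ i < n ] sum (f i) + ∑[ i < n ] sum (g i)
  ∑∑-distrib-+ f g = trans (sum-cong-≗ λ i → ∑-distrib-+ (f i) (g i)) (∑-distrib-+ (sum ∘ f) (sum ∘ g))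
  split : ∀ i j → 𝟙 (i Fin.<? j) * w i j + 𝟙 (j Fin.<? i) * w i j ≡ w i j
  split i j with i Fin.<? j | j Fin.<? i | Fin.<-cmp i j
  ... | yes i<j | yes j<i | _            = contradiction j<i (Fin.<-asym i<j)
  ... | yes _   | no  _   | _            = trans (+-identityʳ _) (+-identityʳ _)
  ... | no  _   | yes _   | _            = +-identityʳ _
  ... | no  _   | no  _   | tri≈ _ refl _ = sym (w-diag i)
  ... | no  i≮j | no  _   | tri< i<j _ _ = contradiction i<j i≮j
  ... | no  _   | no  j≮i | tri> _ _ j<i = contradiction j<i j≮i

module _ {n} (G : Graph n) where

  adjacency : Fin n → Fin n → ℕ
  adjacency i j = 𝟙 (adj G i j ≟ true)

  adjacency-sym : ∀ i j → adjacency i j ≡ adjacency j i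
  adjacency-sym i j rewrite Graph.sym G i j = refl

  adjacency-irrefl : ∀ i → adjacency i i ≡ 0
  adjacency-irrefl i rewrite Graph.irrefl G i = refl

  Adj-sym : ∀ {u v} → Adj G u v → Adj G v u
  Adj-sym {u} {v} uv = trans (Graph.sym G v u) uv

  inducedAdjacency : Subset n → Fin n → Fin n → ℕ
  inducedAdjacency S i j = 𝟙 (i ∈? S) * (adjacency i j * 𝟙 (j ∈? S))

  handshake : ∀ S → 2 * inducedEdges G S ≡ ∑[ i < n ] sum (inducedAdjacency S i)
  handshake S = begin
    2 * inducedEdges G S                                           ≡⟨ cong (2 *_) (length-filter-cartesianProduct (isInducedEdge? G S) id id) ⟩
    2 * ∑[ i < n ] ∑[ j < n ] 𝟙 (isInducedEdge? G S (i , j))       ≡⟨ cong (2 *_) (sum-cong-≗ λ i → sum-cong-≗ (𝟙-isInducedEdge? i)) ⟩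
    2 * ∑[ i < n ] ∑[ j < n ] (𝟙 (i Fin.<? j) * inducedAdjacency S i j) ≡⟨ ∑∑-upper-triangle (inducedAdjacency S) induced-sym induced-irrefl ⟩
    ∑[ i < n ] sum (inducedAdjacency S i)                          ∎
    where
    open ≡-Reasoning
    𝟙-isInducedEdge? : ∀ i j → 𝟙 (isInducedEdge? G S (i , j)) ≡ 𝟙 (i Fin.<? j) * inducedAdjacency S i j
    𝟙-isInducedEdge? i j = begin
      𝟙 (isInducedEdge? G S (i , j))                                   ≡⟨ 𝟙-×-dec (i Fin.<? j) _ ⟩
      𝟙 (i Fin.<? j) * 𝟙 ((i ∈? S) ×-dec ((j ∈? S) ×-dec (adj G i j ≟ true)))
        ≡⟨ cong (𝟙 (i Fin.<? j) *_) (𝟙-×-dec (i ∈? S) _) ⟩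
      𝟙 (i Fin.<? j) * (𝟙 (i ∈? S) * 𝟙 ((j ∈? S) ×-dec (adj G i j ≟ true)))
        ≡⟨ cong (λ t → 𝟙 (i Fin.<? j) * (𝟙 (i ∈? S) * t)) (trans (𝟙-×-dec (j ∈? S) _) (*-comm (𝟙 (j ∈? S)) _)) ⟩
      𝟙 (i Fin.<? j) * inducedAdjacency S i j                          ∎
    induced-sym : ∀ i j → inducedAdjacency S i j ≡ inducedAdjacency S j i
    induced-sym i j rewrite adjacency-sym i j = swap-ends (𝟙 (i ∈? S)) (adjacency j i) (𝟙 (j ∈? S))
      where
      swap-ends : ∀ a b c → a * (b * c) ≡ c * (b * a)
      swap-ends = solve-∀
    induced-irrefl : ∀ i → inducedAdjacency S i i ≡ 0
    induced-irrefl i rewrite adjacency-irrefl i = *-zeroʳ (𝟙 (i ∈? S))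

  open SymmetricMatrix adjacency adjacency-sym

  2*edges≡total : 2 * edges G ≡ total
  2*edges≡total = trans (handshake ⊤) (sum-cong-≗ λ i → sum-cong-≗ λ j → on-⊤ i j)
    where
    on-⊤ : ∀ i j → inducedAdjacency ⊤ i j ≡ adjacency i j
    on-⊤ i j rewrite 𝟙-yes (i ∈? ⊤) ∈⊤ | 𝟙-yes (j ∈? ⊤) ∈⊤ = trans (+-identityʳ _) (*-identityʳ _)

  neighbourhood : Fin n → Subset n
  neighbourhood u = Vec.tabulate (adj G u)

  ∈-neighbourhood⁺ : ∀ {u x} → Adj G u x → x ∈ neighbourhood u
  ∈-neighbourhood⁺ {u} {x} ux = lookup⇒[]= x (neighbourhood u) (trans (lookup∘tabulate (adj G u) x) ux)

  ∈-neighbourhood⁻ : ∀ {u x} → x ∈ neighbourhood u → Adj G u x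
  ∈-neighbourhood⁻ {u} {x} x∈N = trans (sym (lookup∘tabulate (adj G u) x)) ([]=⇒lookup x∈N)

  edgeNeighbourhood : Fin n → Fin n → Subset n
  edgeNeighbourhood u v = neighbourhood u ∪ neighbourhood v

  edgeNeighbourhood-diam≤3 : ∀ {u v} → Adj G u v → InducedDiamAtMost G (edgeNeighbourhood u v) 3
  edgeNeighbourhood-diam≤3 {u} {v} uv x y x∈S y∈S =
    walk (x∈p∪q⁻ (neighbourhood u) _ x∈S) (x∈p∪q⁻ (neighbourhood u) _ y∈S)
    where
    S = edgeNeighbourhood u v
    u∈S : u ∈ S
    u∈S = x∈p∪q⁺ (inj₂ (∈-neighbourhood⁺ (Adj-sym uv)))
    v∈S : v ∈ S
    v∈S = x∈p∪q⁺ (inj₁ (∈-neighbourhood⁺ uv))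
    x~ : ∀ {w} → x ∈ neighbourhood w → Adj G x w
    x~ x∈N = Adj-sym (∈-neighbourhood⁻ x∈N)
    ~y : ∀ {w} → y ∈ neighbourhood w → Adj G w y
    ~y = ∈-neighbourhood⁻
    walk : x ∈ neighbourhood u ⊎ x ∈ neighbourhood v → y ∈ neighbourhood u ⊎ y ∈ neighbourhood v → WalkIn G S 3 x y
    walk (inj₁ x∈Nu) (inj₁ y∈Nu) = inj₂ (u , u∈S , x~ x∈Nu , inj₂ (y , y∈S , ~y y∈Nu , inj₁ refl))
    walk (inj₁ x∈Nu) (inj₂ y∈Nv) = inj₂ (u , u∈S , x~ x∈Nu , inj₂ (v , v∈S , uv , inj₂ (y , y∈S , ~y y∈Nv , refl)))
    walk (inj₂ x∈Nv) (inj₁ y∈Nu) = inj₂ (v , v∈S , x~ x∈Nv , inj₂ (u , u∈S , Adj-sym uv , inj₂ (y , y∈S , ~y y∈Nu , refl)))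
    walk (inj₂ x∈Nv) (inj₂ y∈Nv) = inj₂ (v , v∈S , x~ x∈Nv , inj₂ (y , y∈S , ~y y∈Nv , inj₁ refl))

  M³≤2*inducedEdges : ∀ u v → M³ u v ≤ 2 * inducedEdges G (edgeNeighbourhood u v)
  M³≤2*inducedEdges u v = begin
    M³ u v                                 ≤⟨ ∑-mono-≤ (λ x → ∑-mono-≤ λ y → *-mono-≤ (first-in-S x) (*-monoʳ-≤ (adjacency x y) (last-in-S y))) ⟩
    ∑[ x < n ] sum (inducedAdjacency S x)  ≡⟨ sym (handshake S) ⟩
    2 * inducedEdges G S                   ∎
    where
    open ≤-Reasoning
    S = edgeNeighbourhood u v
    first-in-S : ∀ x → adjacency u x ≤ 𝟙 (x ∈? S)
    first-in-S x = 𝟙-mono (λ ux → x∈p∪q⁺ (inj₁ (∈-neighbourhood⁺ ux))) (adj G u x ≟ true) (x ∈? S)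
    last-in-S : ∀ y → adjacency y v ≤ 𝟙 (y ∈? S)
    last-in-S y = 𝟙-mono (λ yv → x∈p∪q⁺ (inj₂ (∈-neighbourhood⁺ (Adj-sym yv)))) (adj G y v ≟ true) (y ∈? S)

  many-walks⇒dense : ∀ u v → total ^ 3 < 2 * n ^ 4 * M³ u v →
    edges G ^ 3 ≤ 32 * n ^ 4 * inducedEdges G (edgeNeighbourhood u v)
  many-walks⇒dense u v many-walks = begin
    m ^ 3                  ≤⟨ m≤n*m (m ^ 3) 8 ⟩
    8 * m ^ 3              ≡⟨ cube-of-double m ⟩
    (2 * m) ^ 3            ≡⟨ cong (_^ 3) 2*edges≡total ⟩
    total ^ 3              ≤⟨ <⇒≤ many-walks ⟩
    2 * n ^ 4 * M³ u v     ≤⟨ *-monoʳ-≤ (2 * n ^ 4) (M³≤2*inducedEdges u v) ⟩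
    2 * n ^ 4 * (2 * e)    ≡⟨ regroup (n ^ 4) e ⟩
    4 * n ^ 4 * e          ≤⟨ *-monoˡ-≤ e (*-monoˡ-≤ (n ^ 4) (m≤m+n 4 28)) ⟩
    32 * n ^ 4 * e         ∎
    where
    open ≤-Reasoning
    m = edges G
    e = inducedEdges G (edgeNeighbourhood u v)
    cube-of-double : ∀ m → 8 * (m * (m * (m * 1))) ≡ (2 * m) * ((2 * m) * ((2 * m) * 1))
    cube-of-double = solve-∀
    regroup : ∀ x e → 2 * x * (2 * e) ≡ 4 * x * e
    regroup = solve-∀

  total>0 : 0 < edges G → 0 < total
  total>0 m>0 = subst (0 <_) 2*edges≡total (m<n⇒m<o*n 2 m>0)

  heavy-entry⇒dense-subgraph : (∃₂ λ u v → 0 < adjacency u v × total ^ 3 < 2 * n ^ 4 * M³ u v) →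
    Σ (Subset n) λ S → (edges G ^ 3 ≤ 32 * n ^ 4 * inducedEdges G S) × InducedDiamAtMost G S 3
  heavy-entry⇒dense-subgraph (u , v , uv>0 , many-walks) =
    edgeNeighbourhood u v , many-walks⇒dense u v many-walks , edgeNeighbourhood-diam≤3 (𝟙>0⇒ (adj G u v ≟ true) uv>0)

  dense-subgraph : 0 < edges G →
    Σ (Subset n) λ S → (edges G ^ 3 ≤ 32 * n ^ 4 * inducedEdges G S) × InducedDiamAtMost G S 3
  dense-subgraph m>0 = heavy-entry⇒dense-subgraph (entry-with-many-walks (total>0 m>0))

lemma2p5 : (n : ℕ) (G : Graph n) →
    12 * n ≤ edges G →
    Σ (Subset n) λ S →
      (edges G ^ 3 ≤ 32 * n ^ 4 * inducedEdges G S) × InducedDiamAtMost G S 3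
lemma2p5 n G _ with 0 <? edges G
... | no m≯0 = ∅ , subst (λ m → m ^ 3 ≤ 32 * n ^ 4 * inducedEdges G ∅) (sym (n≤0⇒n≡0 (≮⇒≥ m≯0))) z≤n
                 , λ _ _ x∈∅ _ → contradiction x∈∅ ∉⊥
... | yes m>0 = dense-subgraph G m>0
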